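{- For positive integers $k$ and $n>k$ with $n\le k+\sqrt{k}$, every linear code $\mathcal{C}\subseteq\mathbb{F}_2^n$ of dimension $k$ satisfies \[d_{\min}(\mathcal{C})\le4\cdot\frac{n-k}{\log n}+2.\] Furthermore, if $n>k+\sqrt{k}$, then \[d_{\min}(\mathcal{C})\le4\cdot\frac{\sqrt{k}}{\log k}+2+(n-k-\sqrt{k}).\]
   Context: $\log$ is base 2; $d_{\min}$ is the minimum Hamming weight of a nonzero codeword. -}

module Defs where

open import Data.Bool using (Bool; true; false; _xor_; if_then_else_)
open import Data.Nat using (ℕ; zero; suc; _+_; _*_; _∸_; _^_; _≤_; _<_)
open import Data.Integer as ℤ using (ℤ; +_)
open import Data.Vec using (Vec; []; _∷_; replicate; zipWith)
open import Data.Product using (_×_; Σ; ∃)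
open import Data.Sum using (_⊎_)
open import Relation.Binary.PropositionalEquality using (_≡_)
open import Relation.Nullary using (¬_)

_⊕_ : ∀ {n} → Vec Bool n → Vec Bool n → Vec Bool n
_⊕_ = zipWith _xor_

zeroV : ∀ n → Vec Bool n
zeroV n = replicate n false

wt : ∀ {n} → Vec Bool n → ℕ
wt [] = 0
wt (true ∷ v) = suc (wt v)
wt (false ∷ v) = wt v

lincomb : ∀ {n k} → Vec Bool k → Vec (Vec Bool n) k → Vec Bool n
lincomb {n} [] [] = zeroV n
lincomb (b ∷ u) (g ∷ G) = if b then g ⊕ lincomb u G else lincomb u G

-- The k rows of G are linearly independent over 𝔽₂, i.e. they form a basis of
-- the code they span, which therefore has dimension k.
Independent : ∀ {n k} → Vec (Vec Bool n) k → Set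
Independent {n} {k} G = ∀ (u : Vec Bool k) → lincomb u G ≡ zeroV n → u ≡ zeroV k

_∈Code_ : ∀ {n k} → Vec Bool n → Vec (Vec Bool n) k → Set
_∈Code_ {k = k} c G = Σ (Vec Bool k) (λ u → lincomb u G ≡ c)

IsMinDist : ∀ {n k} → Vec (Vec Bool n) k → ℕ → Set
IsMinDist {n} G d =
  (Σ (Vec Bool n) (λ c → c ∈Code G × ¬ (c ≡ zeroV n) × wt c ≡ d))
  × (∀ (c : Vec Bool n) → c ∈Code G → ¬ (c ≡ zeroV n) → d ≤ wt c)

-- LeMulSqrt x c k  encodes the real inequality  x ≤ c · √k  (x c integers, k natural).
LeMulSqrt : ℤ → ℤ → ℕ → Set
LeMulSqrt x c k =
  (x ℤ.≤ + 0 × + 0 ℤ.≤ c)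
  ⊎ (x ℤ.≤ + 0 × c ℤ.< + 0 × (c ℤ.* c) ℤ.* (+ k) ℤ.≤ x ℤ.* x)
  ⊎ (+ 0 ℤ.< x × + 0 ℤ.< c × x ℤ.* x ℤ.≤ (c ℤ.* c) ℤ.* (+ k))

-- Bound1 n k d  encodes  d ≤ 4·(n−k)/log₂ n + 2   (for n ≥ 2, n > k), via the exact
-- equivalence  (d−2)·log₂ n ≤ 4(n−k)  ⇔  n^(d−2) ≤ 2^(4(n−k))  (trivial when d ≤ 2).
Bound1 : ℕ → ℕ → ℕ → Set
Bound1 n k d = n ^ (d ∸ 2) ≤ 2 ^ (4 * (n ∸ k))

-- Bound2 n k d  encodes  d ≤ 4·√k/log₂ k + 2 + (n − k − √k).
-- With m = d − 2 − (n − k) ∈ ℤ, s = √k, L = log₂ k > 0 this is  (m + s)·L ≤ 4s,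
-- which (by density of ℚ) holds iff every rational a/b (a,b ∈ ℕ, b ≥ 1) with
-- a/b < L, i.e. 2^a < k^b, satisfies (a/b)(m + s) ≤ 4s, i.e. a·m ≤ (4b − a)·√k.
-- (For k = 1, where log₂ k = 0 and the bound is +∞/undefined, this is vacuous.)
Bound2 : ℕ → ℕ → ℕ → Set
Bound2 n k d = ∀ (a b : ℕ) → 1 ≤ b → 2 ^ a < k ^ b →
  LeMulSqrt (+ a ℤ.* ((+ d ℤ.- + 2) ℤ.- (+ n ℤ.- + k))) (+ (4 * b) ℤ.- + a) k

-- Let E be a family of words of length N whose pairwise sums have weight below the
-- minimum distance D of a binary code of dimension k and length N = k + s. Then the
-- words c ⊕ x (c a codeword, x ∈ E) are pairwise distinct, so 2^k·|E| ≤ 2^N. All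
-- 2^(s+1) words of length s + 1 give the Singleton bound D ≤ s + 1; the (m+1)^t words
-- made of t blocks of length m = ⌊N/t⌋ with at most one 1 each give, for 2t < D,
-- N^t < 2^s·t^t. By Singleton 4t² ≤ s², so when s² ≤ k the factor t^t is absorbed, and
-- with D ≤ 2t + 2 this yields (D − 2)·log N ≤ 4s. For (n − k)² ≤ k apply this to the
-- code itself (s = n − k); otherwise first puncture p = n − k − ⌊√k⌋ coordinates, which
-- keeps the dimension and leaves minimum distance ≥ d − p, and take s = ⌊√k⌋. In the
-- second case log₂ k is approached from below by rationals a/b, i.e. 2^a < k^b.

module Submission where

open import Defs
open import Algebra.Bundles using (AbelianGroup)
open import Algebra.Structures using (IsAbelianGroup)
open import Data.Bool using (Bool; true; false; _xor_)
open import Data.Bool.Properties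
  using (xor-same; xor-assoc; xor-comm; xor-identityˡ; xor-identityʳ) renaming (_≟_ to _≟ᵇ_)
open import Data.Fin using (Fin; zero; suc; combine; remQuot)
open import Data.Fin.Properties using (2↔Bool; *↔×; combine-remQuot; remQuot-combine; injective⇒≤)
open import Data.Fin.Subset using (⁅_⁆; _∈_)
open import Data.Fin.Subset.Properties using (x∈⁅x⁆; x∈⁅y⁆⇒x≡y)
open import Data.Integer as ℤ using (+_; -[1+_])
import Data.Integer.Properties as ℤ
import Data.Integer.Tactic.RingSolver as ℤ-Solver
open import Data.Nat
  using (ℕ; zero; suc; _+_; _*_; _∸_; _^_; _≤_; _<_; _≤?_; _<?_; z≤n; s≤s; >-nonZero)
open import Data.Nat.DivMod using (_/_; _%_; m/n*n≤m; m≡m%n+[m/n]*n; m%n<n)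
open import Data.Nat.Properties
open import Data.Nat.Tactic.RingSolver using (solve-∀)
open import Data.Product using (_×_; _,_; proj₁; proj₂; map₂; ∃-syntax)
open import Data.Product.Function.NonDependent.Propositional using (_×-↔_)
open import Data.Sum using (_⊎_; inj₁; inj₂)
open import Data.Vec using (Vec; []; _∷_; _++_; map; take; drop; padRight; truncate)
open import Data.Vec.Properties
  using (zipWith-assoc; zipWith-comm; zipWith-identityˡ; zipWith-identityʳ; take-zipWith;
         take++drop≡id; truncate-padRight; ++-injective; ≡-dec)
open import Function using (id; _∘_)
open import Function.Bundles using (_↔_; _↣_; Inverse; Injection; mk↣; mk↔ₛ′)
open import Function.Construct.Composition using (_↣-∘_)
open import Function.Definitions using (Injective)
open import Function.Properties.Inverse using (↔-sym; ↔-refl; ↔-trans; ↔⇒↣)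
open import Level using (0ℓ)
open import Relation.Binary.PropositionalEquality
open import Relation.Nullary using (yes; no; contradiction)

-- The group 𝔽₂ⁿ and Hamming weight

⊕-self : ∀ {n} (x : Vec Bool n) → x ⊕ x ≡ zeroV n
⊕-self []      = refl
⊕-self (b ∷ x) = cong₂ _∷_ (xor-same b) (⊕-self x)

⊕-isAbelianGroup : ∀ n → IsAbelianGroup _≡_ (_⊕_ {n}) (zeroV n) id
⊕-isAbelianGroup n = record
  { isGroup = record
    { isMonoid = record
      { isSemigroup = record
        { isMagma = record { isEquivalence = isEquivalence ; ∙-cong = cong₂ _⊕_ }
        ; assoc = zipWith-assoc xor-assoc
        }
      ; identity = zipWith-identityˡ xor-identityˡ , zipWith-identityʳ xor-identityʳ
      }
    ; inverse = ⊕-self , ⊕-self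
    ; ⁻¹-cong = id
    }
  ; comm = zipWith-comm xor-comm
  }

⊕-abelianGroup : ℕ → AbelianGroup 0ℓ 0ℓ
⊕-abelianGroup n = record { isAbelianGroup = ⊕-isAbelianGroup n }

module _ {n : ℕ} where
  open AbelianGroup (⊕-abelianGroup n) public
    using () renaming (identityˡ to ⊕-identityˡ; identityʳ to ⊕-identityʳ)
  open import Algebra.Properties.AbelianGroup (⊕-abelianGroup n)
    using (inverseˡ-unique)
  open import Algebra.Properties.CommutativeSemigroup
    (AbelianGroup.commutativeSemigroup (⊕-abelianGroup n))
    using (interchange)

  ⊕-interchange : (x y u v : Vec Bool n) → (x ⊕ y) ⊕ (u ⊕ v) ≡ (x ⊕ u) ⊕ (y ⊕ v)
  ⊕-interchange = interchange

  ⊕≡zeroV⇒≡ : ∀ {x y : Vec Bool n} → x ⊕ y ≡ zeroV n → x ≡ y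
  ⊕≡zeroV⇒≡ = inverseˡ-unique _ _

  ⊕-swap : ∀ {x y u v : Vec Bool n} → x ⊕ y ≡ u ⊕ v → x ⊕ u ≡ y ⊕ v
  ⊕-swap {x} {y} {u} {v} eq = ⊕≡zeroV⇒≡ (begin
    (x ⊕ u) ⊕ (y ⊕ v) ≡⟨ ⊕-interchange x u y v ⟩
    (x ⊕ y) ⊕ (u ⊕ v) ≡⟨ cong (_⊕ (u ⊕ v)) eq ⟩
    (u ⊕ v) ⊕ (u ⊕ v) ≡⟨ ⊕-self (u ⊕ v) ⟩
    zeroV n           ∎)
    where open ≡-Reasoning

infix 25 _·_

_·_ : ∀ {n} → Bool → Vec Bool n → Vec Bool n
true  · g = g
false · g = zeroV _

·-distribʳ-xor : ∀ {n} a b (g : Vec Bool n) → (a xor b) · g ≡ a · g ⊕ b · g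
·-distribʳ-xor true  true  g = sym (⊕-self g)
·-distribʳ-xor true  false g = sym (⊕-identityʳ g)
·-distribʳ-xor false b     g = sym (⊕-identityˡ (b · g))

lincomb-∷ : ∀ {n k} b (u : Vec Bool k) (g : Vec Bool n) G →
            lincomb (b ∷ u) (g ∷ G) ≡ b · g ⊕ lincomb u G
lincomb-∷ true  u g G = refl
lincomb-∷ false u g G = sym (⊕-identityˡ (lincomb u G))

lincomb-⊕ : ∀ {n k} (u v : Vec Bool k) (G : Vec (Vec Bool n) k) →
            lincomb (u ⊕ v) G ≡ lincomb u G ⊕ lincomb v G
lincomb-⊕ []      []      []      = sym (⊕-self (zeroV _))
lincomb-⊕ (a ∷ u) (b ∷ v) (g ∷ G) = begin
  lincomb ((a xor b) ∷ (u ⊕ v)) (g ∷ G)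
    ≡⟨ lincomb-∷ (a xor b) (u ⊕ v) g G ⟩
  (a xor b) · g ⊕ lincomb (u ⊕ v) G
    ≡⟨ cong₂ _⊕_ (·-distribʳ-xor a b g) (lincomb-⊕ u v G) ⟩
  (a · g ⊕ b · g) ⊕ (lincomb u G ⊕ lincomb v G)
    ≡⟨ ⊕-interchange (a · g) (b · g) _ _ ⟩
  (a · g ⊕ lincomb u G) ⊕ (b · g ⊕ lincomb v G)
    ≡⟨ sym (cong₂ _⊕_ (lincomb-∷ a u g G) (lincomb-∷ b v g G)) ⟩
  lincomb (a ∷ u) (g ∷ G) ⊕ lincomb (b ∷ v) (g ∷ G)
    ∎
  where open ≡-Reasoning

wt-zeroV : ∀ n → wt (zeroV n) ≡ 0
wt-zeroV zero    = refl
wt-zeroV (suc n) = wt-zeroV n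

wt≤length : ∀ {n} (x : Vec Bool n) → wt x ≤ n
wt≤length []          = z≤n
wt≤length (true  ∷ x) = s≤s (wt≤length x)
wt≤length (false ∷ x) = m≤n⇒m≤1+n (wt≤length x)

wt-⊕ : ∀ {n} (x y : Vec Bool n) → wt (x ⊕ y) ≤ wt x + wt y
wt-⊕ []          []          = z≤n
wt-⊕ (true  ∷ x) (true  ∷ y) =
  ≤-trans (wt-⊕ x y) (≤-trans (+-monoʳ-≤ (wt x) (n≤1+n (wt y))) (n≤1+n _))
wt-⊕ (true  ∷ x) (false ∷ y) = s≤s (wt-⊕ x y)
wt-⊕ (false ∷ x) (true  ∷ y) =
  ≤-trans (s≤s (wt-⊕ x y)) (≤-reflexive (sym (+-suc (wt x) (wt y))))
wt-⊕ (false ∷ x) (false ∷ y) = wt-⊕ x y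

wt-++ : ∀ {m n} (x : Vec Bool m) (y : Vec Bool n) → wt (x ++ y) ≡ wt x + wt y
wt-++ []          y = refl
wt-++ (true  ∷ x) y = cong suc (wt-++ x y)
wt-++ (false ∷ x) y = wt-++ x y

wt-take : ∀ m {n} (x : Vec Bool (m + n)) → wt x ≤ wt (take m x) + n
wt-take m {n} x = begin
  wt x                          ≡⟨ cong wt (sym (take++drop≡id m x)) ⟩
  wt (take m x ++ drop m x)     ≡⟨ wt-++ (take m x) (drop m x) ⟩
  wt (take m x) + wt (drop m x) ≤⟨ +-monoʳ-≤ (wt (take m x)) (wt≤length (drop m x)) ⟩
  wt (take m x) + n             ∎
  where open ≤-Reasoning

wt-⁅⁆ : ∀ {n} (i : Fin n) → wt ⁅ i ⁆ ≡ 1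
wt-⁅⁆ {suc n} zero = cong suc (wt-zeroV n)
wt-⁅⁆ (suc i)      = wt-⁅⁆ i

padRight-⊕ : ∀ {m n} (m≤n : m ≤ n) (x y : Vec Bool m) →
             padRight m≤n false x ⊕ padRight m≤n false y ≡ padRight m≤n false (x ⊕ y)
padRight-⊕ z≤n       []      []      = ⊕-self (zeroV _)
padRight-⊕ (s≤s m≤n) (a ∷ x) (b ∷ y) = cong ((a xor b) ∷_) (padRight-⊕ m≤n x y)

wt-padRight : ∀ {m n} (m≤n : m ≤ n) (x : Vec Bool m) → wt (padRight m≤n false x) ≡ wt x
wt-padRight {n = n} z≤n [] = wt-zeroV n
wt-padRight (s≤s m≤n) (true  ∷ x) = cong suc (wt-padRight m≤n x)
wt-padRight (s≤s m≤n) (false ∷ x) = wt-padRight m≤n x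

padRight-injective : ∀ {m n} (m≤n : m ≤ n) → Injective _≡_ _≡_ (padRight m≤n false)
padRight-injective m≤n {x} {y} eq = begin
  x                                      ≡⟨ sym (truncate-padRight m≤n false x) ⟩
  truncate m≤n (padRight m≤n false x) ≡⟨ cong (truncate m≤n) eq ⟩
  truncate m≤n (padRight m≤n false y) ≡⟨ truncate-padRight m≤n false y ⟩
  y                                      ∎
  where open ≡-Reasoning

-- Codes and puncturing

MinWeightAtLeast : ∀ {n k} → Vec (Vec Bool n) k → ℕ → Set
MinWeightAtLeast {n} G w = ∀ u → wt (lincomb u G) < w → lincomb u G ≡ zeroV n

isMinDist⇒minWeightAtLeast : ∀ {n k} {G : Vec (Vec Bool n) k} {d} →
                              IsMinDist G d → MinWeightAtLeast G d
isMinDist⇒minWeightAtLeast {n} {G = G} (_ , minimal) u wt<d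
  with ≡-dec _≟ᵇ_ (lincomb u G) (zeroV n)
... | yes c≡0 = c≡0
... | no  c≢0 = contradiction (minimal _ (u , refl) c≢0) (<⇒≱ wt<d)

puncture : ∀ m {n k} → Vec (Vec Bool (m + n)) k → Vec (Vec Bool m) k
puncture m = map (take m)

take-zeroV : ∀ m {n} → take m (zeroV (m + n)) ≡ zeroV m
take-zeroV zero    = refl
take-zeroV (suc m) = cong (false ∷_) (take-zeroV m)

take-lincomb : ∀ m {n k} (u : Vec Bool k) (G : Vec (Vec Bool (m + n)) k) →
               take m (lincomb u G) ≡ lincomb u (puncture m G)
take-lincomb m []          []      = take-zeroV m
take-lincomb m (true  ∷ u) (g ∷ G) =
  trans (take-zipWith _xor_ g (lincomb u G)) (cong (take m g ⊕_) (take-lincomb m u G))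
take-lincomb m (false ∷ u) (g ∷ G) = take-lincomb m u G

module _ {m n k D} {G : Vec (Vec Bool (m + n)) k} (G-minWt : MinWeightAtLeast G (D + n)) where

  puncture-kernel : ∀ u → wt (lincomb u (puncture m G)) < D → lincomb u G ≡ zeroV (m + n)
  puncture-kernel u wt<D = G-minWt u (begin-strict
    wt (lincomb u G)                        ≤⟨ wt-take m (lincomb u G) ⟩
    wt (take m (lincomb u G)) + n           ≡⟨ cong (λ c → wt c + n) (take-lincomb m u G) ⟩
    wt (lincomb u (puncture m G)) + n       <⟨ +-monoˡ-< n wt<D ⟩
    D + n                                   ∎)
    where open ≤-Reasoning

  puncture-minWeightAtLeast : MinWeightAtLeast (puncture m G) D
  puncture-minWeightAtLeast u wt<D = begin
    lincomb u (puncture m G)    ≡⟨ sym (take-lincomb m u G) ⟩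
    take m (lincomb u G)        ≡⟨ cong (take m) (puncture-kernel u wt<D) ⟩
    take m (zeroV (m + n))      ≡⟨ take-zeroV m ⟩
    zeroV m                     ∎
    where open ≡-Reasoning

  puncture-independent : 1 ≤ D → Independent G → Independent (puncture m G)
  puncture-independent 1≤D G-indep u c≡0 = G-indep u (puncture-kernel u wt<D)
    where
    wt<D : wt (lincomb u (puncture m G)) < D
    wt<D = subst (λ c → wt c < D) (sym c≡0) (subst (_< D) (sym (wt-zeroV m)) 1≤D)

-- Counting

Vec↔Fin^ : ∀ {A : Set} {m} → A ↔ Fin m → ∀ n → Vec A n ↔ Fin (m ^ n)
Vec↔Fin^ {A} {m} A↔Fin n = mk↔ₛ′ encode decode (encode∘decode {n}) decode∘encode
  where
  open Inverse A↔Fin using (to; from; strictlyInverseˡ; strictlyInverseʳ)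

  encode : ∀ {n} → Vec A n → Fin (m ^ n)
  encode []       = zero
  encode (x ∷ xs) = combine (to x) (encode xs)

  decode : ∀ {n} → Fin (m ^ n) → Vec A n
  decode {zero}  _ = []
  decode {suc n} i = from (proj₁ (remQuot {m} (m ^ n) i)) ∷ decode (proj₂ (remQuot {m} (m ^ n) i))

  encode∘decode : ∀ {n} (i : Fin (m ^ n)) → encode (decode {n} i) ≡ i
  encode∘decode {zero}  zero = refl
  encode∘decode {suc n} i    =
    trans (cong₂ combine (strictlyInverseˡ _) (encode∘decode {n} _)) (combine-remQuot {m} (m ^ n) i)

  decode∘encode : ∀ {n} (xs : Vec A n) → decode (encode xs) ≡ xs
  decode∘encode []       = refl
  decode∘encode (x ∷ xs) =
    trans (cong (λ (i , j) → from i ∷ decode j) (remQuot-combine {m} (to x) (encode xs)))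
          (cong₂ _∷_ (strictlyInverseʳ x) (decode∘encode xs))

↣⇒≤ : ∀ {A B : Set} {m n} → A ↔ Fin m → B ↔ Fin n → A ↣ B → m ≤ n
↣⇒≤ A↔Fin B↔Fin f =
  injective⇒≤ (Injection.injective ((↔⇒↣ B↔Fin ↣-∘ f) ↣-∘ ↔⇒↣ (↔-sym A↔Fin)))

Bool↔Fin2 : Bool ↔ Fin 2
Bool↔Fin2 = ↔-sym 2↔Bool

oneHot : ∀ {m} → Fin (suc m) → Vec Bool m
oneHot zero    = zeroV _
oneHot (suc i) = ⁅ i ⁆

wt-oneHot : ∀ {m} (i : Fin (suc m)) → wt (oneHot i) ≤ 1
wt-oneHot {m} zero = ≤-trans (≤-reflexive (wt-zeroV m)) z≤n
wt-oneHot (suc i)  = ≤-reflexive (wt-⁅⁆ i)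

zeroV≢⁅⁆ : ∀ {m} (i : Fin m) → zeroV m ≢ ⁅ i ⁆
zeroV≢⁅⁆ {m} i eq = 0≢1+n (trans (sym (wt-zeroV m)) (trans (cong wt eq) (wt-⁅⁆ i)))

oneHot-injective : ∀ {m} → Injective _≡_ _≡_ (oneHot {m})
oneHot-injective {x = zero}  {zero}  _  = refl
oneHot-injective {x = zero}  {suc j} eq = contradiction eq (zeroV≢⁅⁆ j)
oneHot-injective {x = suc i} {zero}  eq = contradiction (sym eq) (zeroV≢⁅⁆ i)
oneHot-injective {x = suc i} {suc j} eq = cong suc (x∈⁅y⁆⇒x≡y j (subst (i ∈_) eq (x∈⁅x⁆ i)))

blocks : ∀ {m t} → Vec (Fin (suc m)) t → Vec Bool (t * m)
blocks []       = []
blocks (i ∷ is) = oneHot i ++ blocks is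

wt-blocks : ∀ {m t} (is : Vec (Fin (suc m)) t) → wt (blocks is) ≤ t
wt-blocks []       = z≤n
wt-blocks {t = suc t} (i ∷ is) = begin
  wt (oneHot i ++ blocks is)      ≡⟨ wt-++ (oneHot i) (blocks is) ⟩
  wt (oneHot i) + wt (blocks is)  ≤⟨ +-mono-≤ (wt-oneHot i) (wt-blocks is) ⟩
  1 + t                           ∎
  where open ≤-Reasoning

blocks-injective : ∀ {m t} → Injective _≡_ _≡_ (blocks {m} {t})
blocks-injective {x = []}     {[]}     _  = refl
blocks-injective {x = i ∷ is} {j ∷ js} eq with ++-injective (oneHot i) (oneHot j) eq
... | i≡j , is≡js = cong₂ _∷_ (oneHot-injective i≡j) (blocks-injective is≡js)

^-distribʳ-* : ∀ m n t → (m * n) ^ t ≡ m ^ t * n ^ t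
^-distribʳ-* m n zero    = refl
^-distribʳ-* m n (suc t) =
  trans (cong (m * n *_) (^-distribʳ-* m n t)) ([m*n]*[o*p]≡[m*o]*[n*p] m n (m ^ t) (n ^ t))

n<2^n : ∀ n → n < 2 ^ n
n<2^n zero    = s≤s z≤n
n<2^n (suc n) = +-mono-≤ (m^n>0 2 n) (≤-trans (n<2^n n) (≤-reflexive (sym (+-identityʳ (2 ^ n)))))

m^[2*n]≡m^n*m^n : ∀ m n → m ^ (2 * n) ≡ m ^ n * m ^ n
m^[2*n]≡m^n*m^n m n = trans (cong (m ^_) (cong (_+_ n) (+-identityʳ n))) (^-distribˡ-+-* m n n)

n*n≤4^n : ∀ n → n * n ≤ 4 ^ n
n*n≤4^n n = begin
  n * n         ≤⟨ *-mono-≤ (<⇒≤ (n<2^n n)) (<⇒≤ (n<2^n n)) ⟩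
  2 ^ n * 2 ^ n ≡⟨ sym (^-distribʳ-* 2 2 n) ⟩
  4 ^ n         ∎
  where open ≤-Reasoning

-- a/b < log₂ k ≤ e/t
2^a<k^b⇒a*t<e*b : ∀ {a b k e t} → 1 ≤ t → 2 ^ a < k ^ b → k ^ t ≤ 2 ^ e → a * t < e * b
2^a<k^b⇒a*t<e*b {a} {b} {k} {e} {t@(suc _)} _ 2^a<k^b k^t≤2^e =
  2^-cancel-< (begin-strict
    2 ^ (a * t) ≡⟨ sym (^-*-assoc 2 a t) ⟩
    (2 ^ a) ^ t <⟨ ^-monoˡ-< t 2^a<k^b ⟩
    (k ^ b) ^ t ≡⟨ trans (^-*-assoc k b t) (cong (k ^_) (*-comm b t)) ⟩
    k ^ (t * b) ≡⟨ sym (^-*-assoc k t b) ⟩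
    (k ^ t) ^ b ≤⟨ ^-monoˡ-≤ b k^t≤2^e ⟩
    (2 ^ e) ^ b ≡⟨ ^-*-assoc 2 e b ⟩
    2 ^ (e * b) ∎)
  where
  open ≤-Reasoning
  2^-cancel-< : ∀ {x y} → 2 ^ x < 2 ^ y → x < y
  2^-cancel-< {x} {y} 2^x<2^y = ≰⇒> (λ y≤x → <⇒≱ 2^x<2^y (^-monoʳ-≤ 2 y≤x))

-- Packing bounds

module _ {k N D} {G : Vec (Vec Bool N) k}
         (G-indep : Independent G) (G-minWt : MinWeightAtLeast G D) where

  packing : ∀ {X : Set} (E : X → Vec Bool N) → Injective _≡_ _≡_ E →
            (∀ x y → wt (E x ⊕ E y) < D) → (Vec Bool k × X) ↣ Vec Bool N
  packing E E-inj E-close = mk↣ injective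
    where
    injective : Injective _≡_ _≡_ (λ (u , x) → lincomb u G ⊕ E x)
    injective {u , x} {v , y} eq =
      cong₂ _,_ (⊕≡zeroV⇒≡ (G-indep (u ⊕ v) c≡0))
                (E-inj (⊕≡zeroV⇒≡ (trans (sym c≡) c≡0)))
      where
      c≡ : lincomb (u ⊕ v) G ≡ E x ⊕ E y
      c≡ = trans (lincomb-⊕ u v G) (⊕-swap eq)
      c≡0 : lincomb (u ⊕ v) G ≡ zeroV N
      c≡0 = G-minWt (u ⊕ v) (subst (λ c → wt c < D) (sym c≡) (E-close x y))

module _ {k s D} {G : Vec (Vec Bool (k + s)) k}
         (G-indep : Independent G) (G-minWt : MinWeightAtLeast G D) where

  packing-bound : ∀ {X : Set} {M a} → X ↔ Fin M → a ≤ k + s →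
                  (E : X → Vec Bool a) → Injective _≡_ _≡_ E →
                  (∀ x y → wt (E x ⊕ E y) < D) → M ≤ 2 ^ s
  packing-bound {X} {M} X↔Fin a≤N E E-inj E-close = *-cancelˡ-≤ (2 ^ k) {{m^n≢0 2 k}} (begin
    2 ^ k * M     ≤⟨ ↣⇒≤ (↔-trans (Vec↔Fin^ Bool↔Fin2 k ×-↔ X↔Fin) (↔-sym *↔×))
                         (Vec↔Fin^ Bool↔Fin2 (k + s))
                         (packing G-indep G-minWt padded padded-inj padded-close) ⟩
    2 ^ (k + s)   ≡⟨ ^-distribˡ-+-* 2 k s ⟩
    2 ^ k * 2 ^ s ∎)
    where
    open ≤-Reasoning
    padded : X → Vec Bool (k + s)
    padded = padRight a≤N false ∘ E
    padded-inj : Injective _≡_ _≡_ padded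
    padded-inj = E-inj ∘ padRight-injective a≤N
    padded-close : ∀ x y → wt (padded x ⊕ padded y) < D
    padded-close x y =
      subst (_< D) (sym (trans (cong wt (padRight-⊕ a≤N (E x) (E y))) (wt-padRight a≤N _)))
            (E-close x y)

  singleton-bound : 1 ≤ k → D ≤ suc s
  singleton-bound 1≤k with D ≤? suc s
  ... | yes D≤s+1 = D≤s+1
  ... | no  D≰s+1 = contradiction
    (packing-bound (Vec↔Fin^ Bool↔Fin2 (suc s)) (+-monoˡ-≤ s 1≤k) id id
      (λ x y → ≤-<-trans (wt≤length (x ⊕ y)) (≰⇒> D≰s+1)))
    (<⇒≱ (^-monoʳ-< 2 (s≤s (s≤s z≤n)) (n<1+n s)))

  block-bound : ∀ {t m} → 2 * t < D → t * m ≤ k + s → suc m ^ t ≤ 2 ^ s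
  block-bound {t} 2t<D tm≤N = packing-bound (Vec↔Fin^ ↔-refl t) tm≤N blocks blocks-injective close
    where
    close : ∀ x y → wt (blocks x ⊕ blocks y) < D
    close x y = begin-strict
      wt (blocks x ⊕ blocks y)      ≤⟨ wt-⊕ (blocks x) (blocks y) ⟩
      wt (blocks x) + wt (blocks y) ≤⟨ +-mono-≤ (wt-blocks x) (wt-blocks y) ⟩
      t + t                         ≡⟨ cong (_+_ t) (sym (+-identityʳ t)) ⟩
      2 * t                         <⟨ 2t<D ⟩
      D                             ∎
      where open ≤-Reasoning

  power-bound : ∀ {t} → 1 ≤ t → 2 * t < D → (k + s) ^ t < 2 ^ s * t ^ t
  power-bound {t@(suc _)} _ 2t<D = begin-strict
    N ^ t             <⟨ ^-monoˡ-< t N<[m+1]*t ⟩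
    (suc m * t) ^ t   ≡⟨ ^-distribʳ-* (suc m) t t ⟩
    suc m ^ t * t ^ t ≤⟨ *-monoˡ-≤ (t ^ t) (block-bound 2t<D t*m≤N) ⟩
    2 ^ s * t ^ t     ∎
    where
    open ≤-Reasoning
    N : ℕ
    N = k + s
    m : ℕ
    m = N / t
    t*m≤N : t * m ≤ N
    t*m≤N = ≤-trans (≤-reflexive (*-comm t m)) (m/n*n≤m N t)
    N<[m+1]*t : N < suc m * t
    N<[m+1]*t = begin-strict
      N             ≡⟨ m≡m%n+[m/n]*n N t ⟩
      N % t + m * t <⟨ +-monoˡ-< (m * t) (m%n<n N t) ⟩
      t + m * t     ∎

PackingBounds : ℕ → ℕ → ℕ → Set
PackingBounds N s D = ∀ {t} → 1 ≤ t → 2 * t < D → 2 * t ≤ s × N ^ t < 2 ^ s * t ^ t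

PackingBounds-monoˡ : ∀ {M N s D} → M ≤ N → PackingBounds N s D → PackingBounds M s D
PackingBounds-monoˡ M≤N bounds {t} 1≤t 2t<D =
  map₂ (≤-<-trans (^-monoˡ-≤ t M≤N)) (bounds 1≤t 2t<D)

punctured-bounds : ∀ {n k d} s p → k + s + p ≡ n → (G : Vec (Vec Bool n) k) → Independent G →
                   MinWeightAtLeast G d → 1 ≤ k → PackingBounds (k + s) s (d ∸ p)
punctured-bounds {k = k} {d} s p refl G G-indep G-minWt 1≤k {t} 1≤t 2t<D =
  ≤-pred (≤-trans 2t<D (singleton-bound indep′ minWt′ 1≤k)) ,
  power-bound indep′ minWt′ 1≤t 2t<D
  where
  p<d : p < d
  p<d = m∸n≢0⇒n<m (λ D≡0 → n≮0 (subst (2 * t <_) D≡0 2t<D))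
  G-minWt′ : MinWeightAtLeast G (d ∸ p + p)
  G-minWt′ = subst (MinWeightAtLeast G) (sym (m∸n+n≡m (<⇒≤ p<d))) G-minWt
  indep′ : Independent (puncture (k + s) G)
  indep′ = puncture-independent G-minWt′ (≤-trans (s≤s z≤n) 2t<D) G-indep
  minWt′ : MinWeightAtLeast (puncture (k + s) G) (d ∸ p)
  minWt′ = puncture-minWeightAtLeast G-minWt′

halve : ∀ D → D ≤ 2 ⊎ ∃[ t ] 1 ≤ t × 2 * t < D × D ≤ 2 * t + 2
halve 0 = inj₁ z≤n
halve 1 = inj₁ (s≤s z≤n)
halve 2 = inj₁ ≤-refl
halve (suc (suc (suc D))) with halve (suc D)
... | inj₁ (s≤s D≤1) = inj₂ (1 , ≤-refl , s≤s (s≤s (s≤s z≤n)) , s≤s (s≤s (s≤s D≤1)))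
... | inj₂ (t , _ , 2t<D+1 , D+1≤2t+2) =
  inj₂ (suc t , s≤s z≤n , subst (_< 3 + D) (sym (*-suc 2 t)) (s≤s (s≤s 2t<D+1))
                        , subst (3 + D ≤_) (cong (_+ 2) (sym (*-suc 2 t))) (s≤s (s≤s D+1≤2t+2)))

floor-sqrt : ∀ k → ∃[ s ] s * s ≤ k × k < suc s * suc s
floor-sqrt zero = 0 , z≤n , s≤s z≤n
floor-sqrt (suc k) with floor-sqrt k
... | s , s²≤k , k<[s+1]² with suc k <? suc s * suc s
...   | yes k+1<[s+1]² = s , m≤n⇒m≤1+n s²≤k , k+1<[s+1]²
...   | no  k+1≮[s+1]² =
  suc s , ≤-reflexive (sym k+1≡[s+1]²) ,
  subst (_< suc (suc s) * suc (suc s)) (sym k+1≡[s+1]²) [s+1]²<[s+2]²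
  where
  k+1≡[s+1]² : suc k ≡ suc s * suc s
  k+1≡[s+1]² = ≤-antisym k<[s+1]² (≮⇒≥ k+1≮[s+1]²)
  [s+1]²<[s+2]² : suc s * suc s < suc (suc s) * suc (suc s)
  [s+1]²<[s+2]² = *-mono-< (n<1+n (suc s)) (n<1+n (suc s))

2*t≤s⇒4*[t*t]≤k : ∀ {t s k} → 2 * t ≤ s → s * s ≤ k → 4 * (t * t) ≤ k
2*t≤s⇒4*[t*t]≤k {t} {s} {k} 2t≤s s²≤k = begin
  4 * (t * t)       ≡⟨ lemma t ⟩
  2 * t * (2 * t)   ≤⟨ *-mono-≤ 2t≤s 2t≤s ⟩
  s * s             ≤⟨ s²≤k ⟩
  k                 ∎
  where
  open ≤-Reasoning
  lemma : ∀ t → 4 * (t * t) ≡ 2 * t * (2 * t)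
  lemma = solve-∀

t^t-absorb : ∀ {X s t} → X ^ t < 2 ^ s * t ^ t → t * t ≤ X → X ^ t < 2 ^ (2 * s)
t^t-absorb {X} {s} {t} X^t<2^s*t^t t²≤X = *-cancelʳ-< (X ^ t) (X ^ t) (2 ^ (2 * s)) (begin-strict
  X ^ t * X ^ t                     <⟨ *-mono-< X^t<2^s*t^t X^t<2^s*t^t ⟩
  (2 ^ s * t ^ t) * (2 ^ s * t ^ t) ≡⟨ [m*n]*[o*p]≡[m*o]*[n*p] (2 ^ s) (t ^ t) (2 ^ s) (t ^ t) ⟩
  (2 ^ s * 2 ^ s) * (t ^ t * t ^ t) ≡⟨ sym (cong₂ _*_ (m^[2*n]≡m^n*m^n 2 s) (^-distribʳ-* t t t)) ⟩
  2 ^ (2 * s) * (t * t) ^ t         ≤⟨ *-monoʳ-≤ (2 ^ (2 * s)) (^-monoˡ-≤ t t²≤X) ⟩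
  2 ^ (2 * s) * X ^ t               ∎)
  where open ≤-Reasoning

T^[1+w]≤16*X^w : ∀ {T X} w → T ≤ 16 * 4 ^ w → 4 * T ≤ X → T ^ suc w ≤ 16 * X ^ w
T^[1+w]≤16*X^w {T} {X} w T≤16*4^w 4T≤X = *-cancelˡ-≤ (4 ^ w) {{m^n≢0 4 w}} (begin
  4 ^ w * (T * T ^ w)  ≡⟨ lemma₁ (4 ^ w) T (T ^ w) ⟩
  T * (4 ^ w * T ^ w)  ≡⟨ cong (T *_) (sym (^-distribʳ-* 4 T w)) ⟩
  T * (4 * T) ^ w      ≤⟨ *-mono-≤ T≤16*4^w (^-monoˡ-≤ w 4T≤X) ⟩
  16 * 4 ^ w * X ^ w   ≡⟨ lemma₂ (4 ^ w) (X ^ w) ⟩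
  4 ^ w * (16 * X ^ w) ∎)
  where
  open ≤-Reasoning
  lemma₁ : ∀ a b c → a * (b * c) ≡ b * (a * c)
  lemma₁ = solve-∀
  lemma₂ : ∀ a b → 16 * a * b ≡ a * (16 * b)
  lemma₂ = solve-∀

[t^t]^4≡[t*t]^[2t] : ∀ t → (t ^ t) ^ 4 ≡ (t * t) ^ (2 * t)
[t^t]^4≡[t*t]^[2t] t = begin
  (t ^ t) ^ 4               ≡⟨ ^-*-assoc t t 4 ⟩
  t ^ (t * 4)               ≡⟨ cong (t ^_) (lemma t) ⟩
  t ^ (2 * t + 2 * t)       ≡⟨ ^-distribˡ-+-* t (2 * t) (2 * t) ⟩
  t ^ (2 * t) * t ^ (2 * t) ≡⟨ sym (^-distribʳ-* t t (2 * t)) ⟩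
  (t * t) ^ (2 * t)         ∎
  where
  open ≡-Reasoning
  lemma : ∀ t → t * 4 ≡ 2 * t + 2 * t
  lemma = solve-∀

[1+u]²≤16*4^[2u+1] : ∀ u → suc u * suc u ≤ 16 * 4 ^ (2 * u + 1)
[1+u]²≤16*4^[2u+1] u = begin
  suc u * suc u              ≤⟨ n*n≤4^n (suc u) ⟩
  4 ^ suc u                  ≤⟨ ^-monoʳ-≤ 4 (m≤n+m (suc u) (u + 2)) ⟩
  4 ^ (u + 2 + suc u)        ≡⟨ cong (4 ^_) (lemma u) ⟩
  4 ^ (2 + (2 * u + 1))      ≡⟨ sym (*-assoc 4 4 (4 ^ (2 * u + 1))) ⟩
  16 * 4 ^ (2 * u + 1)       ∎
  where
  open ≤-Reasoning
  lemma : ∀ u → u + 2 + suc u ≡ 2 + (2 * u + 1)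
  lemma = solve-∀

-- X^(4t) < 2^(4s)·t^(4t), and t^(4t) = (t·t)^(2t) ≤ 16·X^(2t−1).
t^t-absorb-odd : ∀ {X s t} → 1 ≤ t → X ^ t < 2 ^ s * t ^ t → 4 * (t * t) ≤ X →
                 X ^ (2 * t + 1) < 2 ^ (4 * suc s)
t^t-absorb-odd {X} {s} {t@(suc u)} _ X^t<2^s*t^t 4t²≤X =
  *-cancelʳ-< (X ^ w) (X ^ (2 * t + 1)) (2 ^ (4 * suc s)) (begin-strict
    X ^ (2 * t + 1) * X ^ w     ≡⟨ sym (^-distribˡ-+-* X (2 * t + 1) w) ⟩
    X ^ (2 * t + 1 + w)         ≡⟨ cong (X ^_) (lemma₁ u) ⟩
    X ^ (t * 4)                 ≡⟨ sym (^-*-assoc X t 4) ⟩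
    (X ^ t) ^ 4                 <⟨ ^-monoˡ-< 4 X^t<2^s*t^t ⟩
    (2 ^ s * t ^ t) ^ 4         ≡⟨ ^-distribʳ-* (2 ^ s) (t ^ t) 4 ⟩
    (2 ^ s) ^ 4 * (t ^ t) ^ 4   ≡⟨ cong₂ _*_ (^-*-assoc 2 s 4) ([t^t]^4≡[t*t]^[2t] t) ⟩
    2 ^ (s * 4) * (t * t) ^ (2 * t)
      ≡⟨ cong (λ e → 2 ^ (s * 4) * (t * t) ^ e) (lemma₂ u) ⟩
    2 ^ (s * 4) * (t * t) ^ suc w
      ≤⟨ *-monoʳ-≤ (2 ^ (s * 4)) (T^[1+w]≤16*X^w w ([1+u]²≤16*4^[2u+1] u) 4t²≤X) ⟩
    2 ^ (s * 4) * (16 * X ^ w)  ≡⟨ sym (*-assoc (2 ^ (s * 4)) 16 (X ^ w)) ⟩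
    2 ^ (s * 4) * 2 ^ 4 * X ^ w ≡⟨ cong (_* X ^ w) (sym (^-distribˡ-+-* 2 (s * 4) 4)) ⟩
    2 ^ (s * 4 + 4) * X ^ w     ≡⟨ cong (λ e → 2 ^ e * X ^ w) (lemma₃ s) ⟩
    2 ^ (4 * suc s) * X ^ w     ∎)
  where
  open ≤-Reasoning
  w : ℕ
  w = 2 * u + 1
  lemma₁ : ∀ u → 2 * suc u + 1 + (2 * u + 1) ≡ suc u * 4
  lemma₁ = solve-∀
  lemma₂ : ∀ u → 2 * suc u ≡ suc (2 * u + 1)
  lemma₂ = solve-∀
  lemma₃ : ∀ s → s * 4 + 4 ≡ 4 * suc s
  lemma₃ = solve-∀

-- a·(D − 2 − s) ≤ (4b − a)·m: the second bound for the punctured code with log₂ k replaced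
-- by a/b and √k by m ∈ {s, s + 1}, both sides moved so that no subtraction occurs.
module _ {a b k s : ℕ} (1≤b : 1 ≤ b) (2^a<k^b : 2 ^ a < k ^ b)
         (s²≤k : s * s ≤ k) (k<[s+1]² : k < suc s * suc s) where

  cleared-bound-floor : ∀ {D} → PackingBounds k s D → a * D + a * s ≤ 4 * b * s + a * (2 + s)
  cleared-bound-floor {D} bounds with halve D
  ... | inj₁ D≤2 = begin
    a * D + a * s           ≤⟨ +-monoˡ-≤ (a * s) (*-monoʳ-≤ a D≤2) ⟩
    a * 2 + a * s           ≡⟨ sym (*-distribˡ-+ a 2 s) ⟩
    a * (2 + s)             ≤⟨ m≤n+m (a * (2 + s)) (4 * b * s) ⟩
    4 * b * s + a * (2 + s) ∎
    where open ≤-Reasoning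
  ... | inj₂ (t , 1≤t , 2t<D , D≤2t+2) = begin
    a * D + a * s                 ≤⟨ +-monoˡ-≤ (a * s) (*-monoʳ-≤ a D≤2t+2) ⟩
    a * (2 * t + 2) + a * s       ≡⟨ lemma₁ a t s ⟩
    2 * (a * t) + a * (2 + s)     ≤⟨ +-monoˡ-≤ (a * (2 + s)) (*-monoʳ-≤ 2 (<⇒≤ at<2sb)) ⟩
    2 * (2 * s * b) + a * (2 + s) ≡⟨ lemma₂ a b s ⟩
    4 * b * s + a * (2 + s)       ∎
    where
    open ≤-Reasoning
    lemma₁ : ∀ a t s → a * (2 * t + 2) + a * s ≡ 2 * (a * t) + a * (2 + s)
    lemma₁ = solve-∀
    lemma₂ : ∀ a b s → 2 * (2 * s * b) + a * (2 + s) ≡ 4 * b * s + a * (2 + s)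
    lemma₂ = solve-∀
    at<2sb : a * t < 2 * s * b
    at<2sb with 2t≤s , k^t<2^s*t^t ← bounds 1≤t 2t<D =
      2^a<k^b⇒a*t<e*b {a} {b} {k} {2 * s} 1≤t 2^a<k^b
        (<⇒≤ (t^t-absorb {k} {s} {t} k^t<2^s*t^t
               (≤-trans (m≤n*m (t * t) 4) (2*t≤s⇒4*[t*t]≤k {t} 2t≤s s²≤k))))

  a≤4b[s+1] : a ≤ 4 * b * suc s
  a≤4b[s+1] = begin
    a             ≡⟨ sym (*-identityʳ a) ⟩
    a * 1         ≤⟨ <⇒≤ (2^a<k^b⇒a*t<e*b {a} {b} {k} {2 * suc s} ≤-refl 2^a<k^b k≤4^[s+1]) ⟩
    2 * suc s * b ≡⟨ lemma b s ⟩
    2 * b * suc s ≤⟨ *-monoˡ-≤ (suc s) (*-monoˡ-≤ b (m≤m+n 2 2)) ⟩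
    4 * b * suc s ∎
    where
    open ≤-Reasoning
    lemma : ∀ b s → 2 * suc s * b ≡ 2 * b * suc s
    lemma = solve-∀
    k≤4^[s+1] : k ^ 1 ≤ 2 ^ (2 * suc s)
    k≤4^[s+1] = begin
      k ^ 1           ≡⟨ *-identityʳ k ⟩
      k               ≤⟨ <⇒≤ k<[s+1]² ⟩
      suc s * suc s   ≤⟨ n*n≤4^n (suc s) ⟩
      4 ^ suc s       ≡⟨ ^-*-assoc 2 2 (suc s) ⟩
      2 ^ (2 * suc s) ∎

  cleared-bound-ceil : ∀ {D} → PackingBounds k s D → a * D + a * suc s ≤ 4 * b * suc s + a * (2 + s)
  cleared-bound-ceil {D} bounds with halve D
  ... | inj₁ D≤2 = begin
    a * D + a * suc s           ≤⟨ +-monoˡ-≤ (a * suc s) (*-monoʳ-≤ a D≤2) ⟩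
    a * 2 + a * suc s           ≡⟨ lemma a s ⟩
    a + a * (2 + s)             ≤⟨ +-monoˡ-≤ (a * (2 + s)) a≤4b[s+1] ⟩
    4 * b * suc s + a * (2 + s) ∎
    where
    open ≤-Reasoning
    lemma : ∀ a s → a * 2 + a * suc s ≡ a + a * (2 + s)
    lemma = solve-∀
  ... | inj₂ (t , 1≤t , 2t<D , D≤2t+2) = begin
    a * D + a * suc s               ≤⟨ +-monoˡ-≤ (a * suc s) (*-monoʳ-≤ a D≤2t+2) ⟩
    a * (2 * t + 2) + a * suc s     ≡⟨ lemma₁ a t s ⟩
    a * (2 * t + 1) + a * (2 + s)   ≤⟨ +-monoˡ-≤ (a * (2 + s)) (<⇒≤ a[2t+1]<4[s+1]b) ⟩
    4 * suc s * b + a * (2 + s)     ≡⟨ cong (_+ a * (2 + s)) (lemma₂ b s) ⟩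
    4 * b * suc s + a * (2 + s)     ∎
    where
    open ≤-Reasoning
    lemma₁ : ∀ a t s → a * (2 * t + 2) + a * suc s ≡ a * (2 * t + 1) + a * (2 + s)
    lemma₁ = solve-∀
    lemma₂ : ∀ b s → 4 * suc s * b ≡ 4 * b * suc s
    lemma₂ = solve-∀
    a[2t+1]<4[s+1]b : a * (2 * t + 1) < 4 * suc s * b
    a[2t+1]<4[s+1]b with 2t≤s , k^t<2^s*t^t ← bounds 1≤t 2t<D =
      2^a<k^b⇒a*t<e*b {a} {b} {k} {4 * suc s} (m≤n+m 1 (2 * t)) 2^a<k^b
        (<⇒≤ (t^t-absorb-odd {k} {s} {t} 1≤t k^t<2^s*t^t (2*t≤s⇒4*[t*t]≤k {t} 2t≤s s²≤k)))

cleared-bound-unpuncture : ∀ {a b d D p s m} → d ≤ p + D →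
                           a * D + a * m ≤ 4 * b * m + a * (2 + s) →
                           a * d + a * m ≤ 4 * b * m + a * (2 + (s + p))
cleared-bound-unpuncture {a} {b} {d} {D} {p} {s} {m} d≤p+D aD+am≤ = begin
  a * d + a * m                     ≤⟨ +-monoˡ-≤ (a * m) (*-monoʳ-≤ a d≤p+D) ⟩
  a * (p + D) + a * m               ≡⟨ lemma₁ a p D m ⟩
  (a * D + a * m) + a * p           ≤⟨ +-monoˡ-≤ (a * p) aD+am≤ ⟩
  (4 * b * m + a * (2 + s)) + a * p ≡⟨ lemma₂ a b m s p ⟩
  4 * b * m + a * (2 + (s + p))     ∎
  where
  open ≤-Reasoning
  lemma₁ : ∀ a p D m → a * (p + D) + a * m ≡ (a * D + a * m) + a * p
  lemma₁ = solve-∀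
  lemma₂ : ∀ a b m s p → (4 * b * m + a * (2 + s)) + a * p ≡ 4 * b * m + a * (2 + (s + p))
  lemma₂ = solve-∀

clear-denominators : ∀ {a b d k n r m} → k + r ≡ n → a * d + a * m ≤ 4 * b * m + a * (2 + r) →
  + a ℤ.* ((+ d ℤ.- + 2) ℤ.- (+ n ℤ.- + k)) ℤ.≤ (+ (4 * b) ℤ.- + a) ℤ.* + m
clear-denominators {a} {b} {d} {k} {_} {r} {m} refl ad+am≤ = begin
  + a ℤ.* ((+ d ℤ.- + 2) ℤ.- (+ (k + r) ℤ.- + k))
    ≡⟨ cong (λ z → + a ℤ.* ((+ d ℤ.- + 2) ℤ.- (z ℤ.- + k))) (ℤ.pos-+ k r) ⟩
  + a ℤ.* ((+ d ℤ.- + 2) ℤ.- ((+ k ℤ.+ + r) ℤ.- + k))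
    ≡⟨ lemma₁ (+ a) (+ d) (+ k) (+ r) (+ m) ⟩
  (+ a ℤ.* + d ℤ.+ + a ℤ.* + m) ℤ.- T
    ≡⟨ cong (ℤ._- T) (sym lhs-cast) ⟩
  + (a * d + a * m) ℤ.- T
    ≤⟨ ℤ.+-monoˡ-≤ (ℤ.- T) (ℤ.+≤+ ad+am≤) ⟩
  + (4 * b * m + a * (2 + r)) ℤ.- T
    ≡⟨ cong (ℤ._- T) rhs-cast ⟩
  (+ 4 ℤ.* + b ℤ.* + m ℤ.+ + a ℤ.* (+ 2 ℤ.+ + r)) ℤ.- T
    ≡⟨ lemma₂ (+ a) (+ b) (+ r) (+ m) ⟩
  (+ 4 ℤ.* + b ℤ.- + a) ℤ.* + m
    ≡⟨ cong (λ z → (z ℤ.- + a) ℤ.* + m) (sym (ℤ.pos-* 4 b)) ⟩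
  (+ (4 * b) ℤ.- + a) ℤ.* + m
    ∎
  where
  open ℤ.≤-Reasoning
  T : ℤ.ℤ
  T = + a ℤ.* + m ℤ.+ + a ℤ.* (+ 2 ℤ.+ + r)
  lemma₁ : ∀ a d k r m → a ℤ.* ((d ℤ.- + 2) ℤ.- ((k ℤ.+ r) ℤ.- k)) ≡
                         (a ℤ.* d ℤ.+ a ℤ.* m) ℤ.- (a ℤ.* m ℤ.+ a ℤ.* (+ 2 ℤ.+ r))
  lemma₁ = ℤ-Solver.solve-∀
  lemma₂ : ∀ a b r m →
           (+ 4 ℤ.* b ℤ.* m ℤ.+ a ℤ.* (+ 2 ℤ.+ r)) ℤ.- (a ℤ.* m ℤ.+ a ℤ.* (+ 2 ℤ.+ r)) ≡
           (+ 4 ℤ.* b ℤ.- a) ℤ.* m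
  lemma₂ = ℤ-Solver.solve-∀
  lhs-cast : + (a * d + a * m) ≡ + a ℤ.* + d ℤ.+ + a ℤ.* + m
  lhs-cast = trans (ℤ.pos-+ (a * d) (a * m)) (cong₂ ℤ._+_ (ℤ.pos-* a d) (ℤ.pos-* a m))
  rhs-cast : + (4 * b * m + a * (2 + r)) ≡ + 4 ℤ.* + b ℤ.* + m ℤ.+ + a ℤ.* (+ 2 ℤ.+ + r)
  rhs-cast = trans (ℤ.pos-+ (4 * b * m) (a * (2 + r)))
    (cong₂ ℤ._+_ (trans (ℤ.pos-* (4 * b) m) (cong (ℤ._* + m) (ℤ.pos-* 4 b)))
                 (trans (ℤ.pos-* a (2 + r)) (cong (+ a ℤ.*_) (ℤ.pos-+ 2 r))))

-- For s = ⌊√k⌋, c·√k ≥ min (c·s) (c·(s + 1)).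
LeMulSqrt-intro : ∀ {x c k s} → s * s ≤ k → k < suc s * suc s →
                  x ℤ.≤ c ℤ.* + s → x ℤ.≤ c ℤ.* + suc s → LeMulSqrt x c k
LeMulSqrt-intro { -[1+ _ ]} {+ _}      _ _ _ _ = inj₁ (ℤ.-≤+ , ℤ.+≤+ z≤n)
LeMulSqrt-intro {+ zero}   {+ _}      _ _ _ _ = inj₁ (ℤ.+≤+ z≤n , ℤ.+≤+ z≤n)
LeMulSqrt-intro {+ suc _}  {+ zero}   _ _ (ℤ.+≤+ ()) _
LeMulSqrt-intro {+ suc X}  {+ suc C} {k} {s} s²≤k _ x≤c*s _ =
  inj₂ (inj₂ (ℤ.+<+ (s≤s z≤n) , ℤ.+<+ (s≤s z≤n) ,
              subst (+ (suc X * suc X) ℤ.≤_) (ℤ.pos-* (suc C * suc C) k) (ℤ.+≤+ x²≤c²k)))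
  where
  open ≤-Reasoning
  x≤cs : suc X ≤ suc C * s
  x≤cs = ℤ.drop‿+≤+ (subst (+ suc X ℤ.≤_) (sym (ℤ.pos-* (suc C) s)) x≤c*s)
  x²≤c²k : suc X * suc X ≤ suc C * suc C * k
  x²≤c²k = begin
    suc X * suc X             ≤⟨ *-mono-≤ x≤cs x≤cs ⟩
    suc C * s * (suc C * s)   ≡⟨ [m*n]*[o*p]≡[m*o]*[n*p] (suc C) s (suc C) s ⟩
    suc C * suc C * (s * s)   ≤⟨ *-monoʳ-≤ (suc C * suc C) s²≤k ⟩
    suc C * suc C * k         ∎
LeMulSqrt-intro {+ _}      { -[1+ _ ]} _ _ _ ()
LeMulSqrt-intro { -[1+ X ]} { -[1+ C ]} {k} {s} _ k<[s+1]² _ (ℤ.-≤- x≤c[s+1]) =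
  inj₂ (inj₁ (ℤ.-≤+ , ℤ.-<+ ,
              subst (ℤ._≤ + (suc X * suc X)) (ℤ.pos-* (suc C * suc C) k) (ℤ.+≤+ c²k≤x²)))
  where
  open ≤-Reasoning
  c²k≤x² : suc C * suc C * k ≤ suc X * suc X
  c²k≤x² = begin
    suc C * suc C * k                   ≤⟨ *-monoʳ-≤ (suc C * suc C) (<⇒≤ k<[s+1]²) ⟩
    suc C * suc C * (suc s * suc s)     ≡⟨ [m*n]*[o*p]≡[m*o]*[n*p] (suc C) (suc C) (suc s) (suc s) ⟩
    suc C * suc s * (suc C * suc s)     ≤⟨ *-mono-≤ (s≤s x≤c[s+1]) (s≤s x≤c[s+1]) ⟩
    suc X * suc X                       ∎

n^[d∸2]≤2^[4r] : ∀ {n t r d} → 1 ≤ n → n ^ t < 2 ^ (2 * r) → d ≤ 2 * t + 2 →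
                 n ^ (d ∸ 2) ≤ 2 ^ (4 * r)
n^[d∸2]≤2^[4r] {n} {t} {r} {d} 1≤n n^t<4^r d≤2t+2 = begin
  n ^ (d ∸ 2)               ≤⟨ ^-monoʳ-≤ n {{>-nonZero 1≤n}} d∸2≤2t ⟩
  n ^ (2 * t)               ≡⟨ m^[2*n]≡m^n*m^n n t ⟩
  n ^ t * n ^ t             ≤⟨ *-mono-≤ (<⇒≤ n^t<4^r) (<⇒≤ n^t<4^r) ⟩
  2 ^ (2 * r) * 2 ^ (2 * r) ≡⟨ sym (m^[2*n]≡m^n*m^n 2 (2 * r)) ⟩
  2 ^ (2 * (2 * r))         ≡⟨ cong (2 ^_) (sym (*-assoc 2 2 r)) ⟩
  2 ^ (4 * r)               ∎
  where
  open ≤-Reasoning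
  d∸2≤2t : d ∸ 2 ≤ 2 * t
  d∸2≤2t = ≤-trans (∸-monoˡ-≤ 2 d≤2t+2) (≤-reflexive (m+n∸n≡m (2 * t) 2))

bound₁ : ∀ {k n d} (G : Vec (Vec Bool n) k) → Independent G → MinWeightAtLeast G d →
         1 ≤ k → k < n → (n ∸ k) ^ 2 ≤ k → Bound1 n k d
bound₁ {k} {n} {d} G G-indep G-minWt 1≤k k<n r²≤k with halve d
... | inj₁ d≤2 =
  subst (λ e → n ^ e ≤ 2 ^ (4 * (n ∸ k))) (sym (m≤n⇒m∸n≡0 d≤2)) (m^n>0 2 (4 * (n ∸ k)))
... | inj₂ (t , 1≤t , 2t<d , d≤2t+2) =
  n^[d∸2]≤2^[4r] {n} {t} {r} (≤-trans 1≤k (<⇒≤ k<n))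
    (t^t-absorb {n} {r} {t} n^t<2^r*t^t t*t≤n) d≤2t+2
  where
  r : ℕ
  r = n ∸ k
  k+r≡n : k + r ≡ n
  k+r≡n = m+[n∸m]≡n (<⇒≤ k<n)
  bounds : 2 * t ≤ r × n ^ t < 2 ^ r * t ^ t
  bounds = subst (λ N → PackingBounds N r d) k+r≡n
    (punctured-bounds r 0 (trans (+-identityʳ (k + r)) k+r≡n) G G-indep G-minWt 1≤k) 1≤t 2t<d
  n^t<2^r*t^t : n ^ t < 2 ^ r * t ^ t
  n^t<2^r*t^t = proj₂ bounds
  r*r≤k : r * r ≤ k
  r*r≤k = subst (_≤ k) (cong (r *_) (*-identityʳ r)) r²≤k
  t*t≤n : t * t ≤ n
  t*t≤n = begin
    t * t       ≤⟨ m≤n*m (t * t) 4 ⟩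
    4 * (t * t) ≤⟨ 2*t≤s⇒4*[t*t]≤k {t} (proj₁ bounds) r*r≤k ⟩
    k           <⟨ k<n ⟩
    n           ∎
    where open ≤-Reasoning

bound₂ : ∀ {k n d} (G : Vec (Vec Bool n) k) → Independent G → MinWeightAtLeast G d →
         1 ≤ k → k < n → k < (n ∸ k) ^ 2 → Bound2 n k d
bound₂ {k} {n} {d} G G-indep G-minWt 1≤k k<n k<r² a b 1≤b 2^a<k^b =
  LeMulSqrt-intro s²≤k k<[s+1]²
    (clear-denominators {a} {b} {d} {k} {n} {s + p} {s} k+[s+p]≡n
      (cleared-bound-unpuncture {a} {b} {d} {D} {p} {s} {s} d≤p+D
        (cleared-bound-floor {a} {b} {k} {s} 1≤b 2^a<k^b s²≤k k<[s+1]² bounds)))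
    (clear-denominators {a} {b} {d} {k} {n} {s + p} {suc s} k+[s+p]≡n
      (cleared-bound-unpuncture {a} {b} {d} {D} {p} {s} {suc s} d≤p+D
        (cleared-bound-ceil {a} {b} {k} {s} 1≤b 2^a<k^b s²≤k k<[s+1]² bounds)))
  where
  r : ℕ
  r = n ∸ k
  s : ℕ
  s = proj₁ (floor-sqrt k)
  s²≤k : s * s ≤ k
  s²≤k = proj₁ (proj₂ (floor-sqrt k))
  k<[s+1]² : k < suc s * suc s
  k<[s+1]² = proj₂ (proj₂ (floor-sqrt k))
  s<r : s < r
  s<r = ≰⇒> λ r≤s → <⇒≱ (subst (k <_) (cong (r *_) (*-identityʳ r)) k<r²)
                         (≤-trans (*-mono-≤ r≤s r≤s) s²≤k)
  p : ℕ
  p = r ∸ s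
  D : ℕ
  D = d ∸ p
  k+[s+p]≡n : k + (s + p) ≡ n
  k+[s+p]≡n = trans (cong (_+_ k) (m+[n∸m]≡n (<⇒≤ s<r))) (m+[n∸m]≡n (<⇒≤ k<n))
  d≤p+D : d ≤ p + D
  d≤p+D = m≤n+m∸n d p
  bounds : PackingBounds k s D
  bounds = PackingBounds-monoˡ (m≤m+n k s)
    (punctured-bounds s p (trans (+-assoc k s p) k+[s+p]≡n) G G-indep G-minWt 1≤k)

mainTheorem16 : (k n : ℕ) → 1 ≤ k → k < n →
    (G : Vec (Vec Bool n) k) → Independent G →
    (d : ℕ) → IsMinDist G d →
    ((n ∸ k) ^ 2 ≤ k → Bound1 n k d) × (k < (n ∸ k) ^ 2 → Bound2 n k d)
mainTheorem16 k n 1≤k k<n G G-indep d d-isMinDist =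
  bound₁ G G-indep G-minWt 1≤k k<n , bound₂ G G-indep G-minWt 1≤k k<n
  where
  G-minWt : MinWeightAtLeast G d
  G-minWt = isMinDist⇒minWeightAtLeast d-isMinDist
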